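{- For all nonnegative integers $L,M$, \[ \sum_{i,j\in\mathbb Z}(-1)^{i+j} q^{\binom{i+j+1}{2}} \begin{bmatrix}2L+1\\ L-i\end{bmatrix}_{q} \begin{bmatrix}2M+1\\ M-j\end{bmatrix}_{q}=-(q)_{2L+1}\,\delta_{L,M}, \] where $\delta_{L,M}$ is the Kronecker delta.
   Context: $\binom{n}{2}:=n(n-1)/2$. The Gaussian binomial is $\begin{bmatrix}n+m\\ n\end{bmatrix}_q=\frac{(q)_{n+m}}{(q)_n(q)_m}$ if $n,m$ are nonnegative integers and $0$ otherwise, where $(q)_n=\prod_{j=1}^n(1-q^j)$. -}

module Defs where

open import Data.Nat as ℕ using (ℕ; zero; suc)
open import Data.Integer as ℤ using (ℤ; +_; -[1+_]; ∣_∣)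
open import Data.Rational using (ℚ; 0ℚ; 1ℚ; _+_; _*_; -_; _-_; 1/_; ≢-nonZero)
open import Data.Rational.Properties using (_≟_)
open import Relation.Nullary using (yes; no)

_^ℚ_ : ℚ → ℕ → ℚ
q ^ℚ zero  = 1ℚ
q ^ℚ suc n = q * (q ^ℚ n)

-- total inverse on ℚ (inv 0 = 0); only ever applied to nonzero values
-- under the hypotheses of the theorem
inv : ℚ → ℚ
inv p with p ≟ 0ℚ
... | yes _  = 0ℚ
... | no p≢0 = 1/_ p {{≢-nonZero p≢0}}

poch : ℚ → ℕ → ℚ
poch q zero    = 1ℚ
poch q (suc n) = poch q n * (1ℚ - q ^ℚ suc n)

-- Gaussian binomial [n+m ; n]_q for integers n, m:
-- (q)_{n+m} / ((q)_n (q)_m) if n, m ≥ 0, and 0 otherwise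
gauss : ℚ → ℤ → ℤ → ℚ
gauss q (+ n) (+ m) = poch q (n ℕ.+ m) * inv (poch q n * poch q m)
gauss q _     _     = 0ℚ

-- binom(t,2) = t(t-1)/2 for an integer t (always a nonnegative integer)
binom2 : ℤ → ℕ
binom2 t = ∣ t ℤ.* (t ℤ.- ℤ.1ℤ) ∣ ℕ./ 2

-- (-1)^k for an integer k (parity of |k| equals parity of k)
sgn : ℤ → ℚ
sgn k = (- 1ℚ) ^ℚ ∣ k ∣

δ : ℕ → ℕ → ℚ
δ a b with a ℕ.≟ b
... | yes _ = 1ℚ
... | no _  = 0ℚ

sumSym : ℕ → (ℤ → ℚ) → ℚ
sumSym K f = go (suc (K ℕ.+ K))
  where
  go : ℕ → ℚ
  go zero    = 0ℚ
  go (suc n) = f ((+ n) ℤ.- (+ K)) + go n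

{-# OPTIONS --safe #-}

-- Write s = i + M.  Substituting j = M - l turns the inner sum over j into
-- (-1)^s V(2M+1, s), where V(N, s) = Σ_l (-1)^l [N; l]_q q^binom(l-s, 2).  The q-Pascal
-- rule gives V(N+1, s) = (1 - q^(N-s)) V(N, s) for s ≤ N, so V(2M+1, s) = 0 for
-- 0 ≤ s ≤ 2M, while V(N, -1) = (q)_N.  Since [2L+1; L-i]_q vanishes unless -L-1 ≤ i ≤ L,
-- for L ≤ M every surviving s lies in [0, 2M], except s = -1, which occurs only for
-- L = M and i = -L-1.  The case L > M follows from the symmetry of the summand in i and j.

module Submission where

open import Defs
open import Data.Nat as ℕ using (ℕ; zero; suc; _≤_; _<_)
open import Data.Nat.DivMod using (m*n/n≡m)
import Data.Nat.Properties as ℕP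
import Data.Nat.Tactic.RingSolver as ℕ-Ring
open import Data.Integer as ℤ using (ℤ; +_; -[1+_]; ∣_∣)
import Data.Integer.Properties as ℤP
import Data.Integer.Tactic.RingSolver as ℤ-Ring
open import Data.Rational as ℚ using (ℚ; 0ℚ; 1ℚ; _+_; _*_; -_; _-_)
import Data.Rational.Properties as ℚP
open import Data.Rational.Solver using (module +-*-Solver)
open +-*-Solver using (solve; _:=_; _:+_; _:*_; _:-_; :-_; con)
open import Algebra.Properties.Group ℚP.+-0-group using (x∙y⁻¹≈ε⇒x≈y)
open import Data.Product using (∃; _,_)
open import Data.Sum using (_⊎_; inj₁; inj₂)
open import Data.Empty using (⊥)
open import Function using (_∘_)
open import Relation.Binary.Definitions using (tri<; tri≈; tri>)
open import Relation.Binary.PropositionalEquality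
open import Relation.Nullary using (yes; no; contradiction)

∑< : ℕ → (ℕ → ℚ) → ℚ
∑< zero    g = 0ℚ
∑< (suc n) g = g n + ∑< n g

infixl 10 ∑<
syntax ∑< n (λ m → g) = ∑[ m < n ] g

∑-unique : ∀ (g G : ℕ → ℚ) → G zero ≡ 0ℚ → (∀ n → G (suc n) ≡ g n + G n) →
           ∀ n → G n ≡ ∑< n g
∑-unique g G G0 Gsuc zero    = G0
∑-unique g G G0 Gsuc (suc n) = trans (Gsuc n) (cong (_+_ (g n)) (∑-unique g G G0 Gsuc n))

∑-cong : ∀ n {g h : ℕ → ℚ} → (∀ {m} → m < n → g m ≡ h m) → ∑< n g ≡ ∑< n h
∑-cong zero    eq = refl
∑-cong (suc n) eq = cong₂ _+_ (eq ℕP.≤-refl) (∑-cong n (eq ∘ ℕP.m<n⇒m<1+n))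

∑-zero : ∀ n {g : ℕ → ℚ} → (∀ {m} → m < n → g m ≡ 0ℚ) → ∑< n g ≡ 0ℚ
∑-zero zero    eq = refl
∑-zero (suc n) eq = cong₂ _+_ (eq ℕP.≤-refl) (∑-zero n (eq ∘ ℕP.m<n⇒m<1+n))

∑-distrib-+ : ∀ n (g h : ℕ → ℚ) → ∑[ m < n ] (g m + h m) ≡ ∑< n g + ∑< n h
∑-distrib-+ zero    g h = refl
∑-distrib-+ (suc n) g h =
  trans (cong (_+_ (g n + h n)) (∑-distrib-+ n g h))
        (interchange (g n) (h n) (∑< n g) (∑< n h))
  where
  interchange : ∀ a b c d → (a + b) + (c + d) ≡ (a + c) + (b + d)
  interchange = solve 4 (λ a b c d → (a :+ b) :+ (c :+ d) := (a :+ c) :+ (b :+ d)) refl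

*-distribˡ-∑ : ∀ n c (g : ℕ → ℚ) → c * ∑< n g ≡ ∑[ m < n ] (c * g m)
*-distribˡ-∑ zero    c g = ℚP.*-zeroʳ c
*-distribˡ-∑ (suc n) c g =
  trans (ℚP.*-distribˡ-+ c (g n) (∑< n g)) (cong (_+_ (c * g n)) (*-distribˡ-∑ n c g))

∑-shift : ∀ n (g : ℕ → ℚ) → ∑< (suc n) g ≡ g 0 + ∑[ m < n ] g (suc m)
∑-shift zero    g = refl
∑-shift (suc n) g =
  trans (cong (_+_ (g (suc n))) (∑-shift n g)) (left-comm (g (suc n)) (g 0) _)
  where
  left-comm : ∀ a b c → a + (b + c) ≡ b + (a + c)
  left-comm = solve 3 (λ a b c → a :+ (b :+ c) := b :+ (a :+ c)) refl

∑-split : ∀ a b (g : ℕ → ℚ) → ∑< (a ℕ.+ b) g ≡ ∑< a g + ∑[ m < b ] g (a ℕ.+ m)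
∑-split zero    b g = sym (ℚP.+-identityˡ _)
∑-split (suc a) b g = begin
    ∑< (suc a ℕ.+ b) g
  ≡⟨ ∑-shift (a ℕ.+ b) g ⟩
    g 0 + ∑[ m < a ℕ.+ b ] g (suc m)
  ≡⟨ cong (_+_ (g 0)) (∑-split a b (λ m → g (suc m))) ⟩
    g 0 + (∑[ m < a ] g (suc m) + ∑[ m < b ] g (suc a ℕ.+ m))
  ≡⟨ sym (ℚP.+-assoc (g 0) _ _) ⟩
    (g 0 + ∑[ m < a ] g (suc m)) + ∑[ m < b ] g (suc a ℕ.+ m)
  ≡⟨ cong (_+ ∑[ m < b ] g (suc a ℕ.+ m)) (sym (∑-shift a g)) ⟩
    ∑< (suc a) g + ∑[ m < b ] g (suc a ℕ.+ m)
  ∎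
  where open ≡-Reasoning

∑-swap : ∀ a b (F : ℕ → ℕ → ℚ) → ∑[ i < a ] ∑< b (F i) ≡ ∑[ j < b ] ∑[ i < a ] F i j
∑-swap zero    b F = sym (∑-zero b (λ _ → refl))
∑-swap (suc a) b F =
  trans (cong (_+_ (∑< b (F a))) (∑-swap a b F))
        (sym (∑-distrib-+ b (F a) (λ j → ∑[ i < a ] F i j)))

∑-reverse : ∀ n (g h : ℕ → ℚ) → (∀ a b → suc (a ℕ.+ b) ≡ n → g a ≡ h b) →
            ∑< n g ≡ ∑< n h
∑-reverse zero    g h mirror = refl
∑-reverse (suc n) g h mirror =
  trans (cong₂ _+_ (mirror n 0 (cong suc (ℕP.+-identityʳ n)))
                   (∑-reverse n g (λ b → h (suc b)) mirror′))
        (sym (∑-shift n h))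
  where
  mirror′ : ∀ a b → suc (a ℕ.+ b) ≡ n → g a ≡ h (suc b)
  mirror′ a b a+b+1≡n = mirror a (suc b) (cong suc (trans (ℕP.+-suc a b) a+b+1≡n))

∑-window : ∀ d n e (g : ℕ → ℚ) →
           (∀ {m} → m < d → g m ≡ 0ℚ) → (∀ {m} → m < e → g (d ℕ.+ n ℕ.+ m) ≡ 0ℚ) →
           ∑< (d ℕ.+ n ℕ.+ e) g ≡ ∑[ m < n ] g (d ℕ.+ m)
∑-window d n e g below above = begin
    ∑< (d ℕ.+ n ℕ.+ e) g
  ≡⟨ ∑-split (d ℕ.+ n) e g ⟩
    ∑< (d ℕ.+ n) g + ∑[ m < e ] g (d ℕ.+ n ℕ.+ m)
  ≡⟨ cong₂ _+_ (∑-split d n g) (∑-zero e above) ⟩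
    (∑< d g + window) + 0ℚ
  ≡⟨ cong (λ x → (x + window) + 0ℚ) (∑-zero d below) ⟩
    (0ℚ + window) + 0ℚ
  ≡⟨ ℚP.+-identityʳ (0ℚ + window) ⟩
    0ℚ + window
  ≡⟨ ℚP.+-identityˡ window ⟩
    window
  ∎
  where
  open ≡-Reasoning
  window = ∑[ m < n ] g (d ℕ.+ m)

-- Generalising over K + K exposes the local recursion inside sumSym to ∑-unique.
sumSym≡∑ : ∀ K (f : ℤ → ℚ) → sumSym K f ≡ ∑[ m < suc (K ℕ.+ K) ] f (+ m ℤ.- + K)
sumSym≡∑ K f with K ℕ.+ K | ∑-unique (λ m → f (+ m ℤ.- + K)) _ refl (λ _ → refl)
... | n | go≡∑ = cong (_+_ (f (+ n ℤ.- + K))) (go≡∑ n)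

sumSym-cong : ∀ K {f g : ℤ → ℚ} → (∀ i → f i ≡ g i) → sumSym K f ≡ sumSym K g
sumSym-cong K {f} {g} f≗g =
  trans (sumSym≡∑ K f)
        (trans (∑-cong (suc (K ℕ.+ K)) (λ {m} _ → f≗g (+ m ℤ.- + K))) (sym (sumSym≡∑ K g)))

sumSym-swap : ∀ K (F : ℤ → ℤ → ℚ) →
              sumSym K (λ i → sumSym K (F i)) ≡ sumSym K (λ j → sumSym K (λ i → F i j))
sumSym-swap K F = begin
    sumSym K (λ i → sumSym K (F i))
  ≡⟨ sumSym≡∑ K (λ i → sumSym K (F i)) ⟩
    ∑[ m < n ] sumSym K (F (ι m))
  ≡⟨ ∑-cong n (λ {m} _ → sumSym≡∑ K (F (ι m))) ⟩
    ∑[ m < n ] ∑[ m′ < n ] F (ι m) (ι m′)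
  ≡⟨ ∑-swap n n (λ m m′ → F (ι m) (ι m′)) ⟩
    ∑[ m′ < n ] ∑[ m < n ] F (ι m) (ι m′)
  ≡⟨ ∑-cong n (λ {m′} _ → sym (sumSym≡∑ K (λ i → F i (ι m′)))) ⟩
    ∑[ m′ < n ] sumSym K (λ i → F i (ι m′))
  ≡⟨ sym (sumSym≡∑ K (λ j → sumSym K (λ i → F i j))) ⟩
    sumSym K (λ j → sumSym K (λ i → F i j))
  ∎
  where
  open ≡-Reasoning
  n = suc (K ℕ.+ K)
  ι : ℕ → ℤ
  ι m = + m ℤ.- + K

sumSym-window : ∀ N {K} (f : ℤ → ℚ) → suc N ≤ K →
                (∀ k → f (-[1+ N ] ℤ.- + suc k) ≡ 0ℚ) → (∀ k → f (+ N ℤ.+ + suc k) ≡ 0ℚ) →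
                sumSym K f ≡ ∑[ l < suc (suc (N ℕ.+ N)) ] f (+ N ℤ.- + l)
sumSym-window N f N<K below above with ℕP.m≤n⇒∃[o]m+o≡n N<K
... | d , refl = begin
    sumSym K f
  ≡⟨ sumSym≡∑ K f ⟩
    ∑< (suc (K ℕ.+ K)) g
  ≡⟨ cong (λ n → ∑< n g) (size N d) ⟩
    ∑< (d ℕ.+ W ℕ.+ suc d) g
  ≡⟨ ∑-window d W (suc d) g below′ above′ ⟩
    ∑[ m < W ] g (d ℕ.+ m)
  ≡⟨ ∑-reverse W _ _ mirror ⟩
    ∑[ l < W ] f (+ N ℤ.- + l)
  ∎
  where
  open ≡-Reasoning
  K = suc N ℕ.+ d
  W = suc (suc (N ℕ.+ N))
  g : ℕ → ℚ
  g m = f (+ m ℤ.- + K)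
  size : ∀ N d → suc ((suc N ℕ.+ d) ℕ.+ (suc N ℕ.+ d)) ≡ d ℕ.+ suc (suc (N ℕ.+ N)) ℕ.+ suc d
  size = ℕ-Ring.solve-∀
  -- + m ℤ.+ + n and ℤ.1ℤ ℤ.+ + n compute to + (m ℕ.+ n) and + suc n, so the ring
  -- identities below apply directly to the natural-number indices.
  lower : ∀ m N k → m ℤ.- ((ℤ.1ℤ ℤ.+ N) ℤ.+ ((ℤ.1ℤ ℤ.+ m) ℤ.+ k)) ≡
                    ℤ.- (ℤ.1ℤ ℤ.+ N) ℤ.- (ℤ.1ℤ ℤ.+ k)
  lower = ℤ-Ring.solve-∀
  upper : ∀ d N m → (d ℤ.+ (ℤ.1ℤ ℤ.+ (ℤ.1ℤ ℤ.+ (N ℤ.+ N))) ℤ.+ m)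
                      ℤ.- ((ℤ.1ℤ ℤ.+ N) ℤ.+ d) ≡
                    N ℤ.+ (ℤ.1ℤ ℤ.+ m)
  upper = ℤ-Ring.solve-∀
  below′ : ∀ {m} → m < d → g m ≡ 0ℚ
  below′ {m} m<d with ℕP.m≤n⇒∃[o]m+o≡n m<d
  ... | k , m+k≡d = trans (cong (λ d → f (+ m ℤ.- + (suc N ℕ.+ d))) (sym m+k≡d))
                          (trans (cong f (lower (+ m) (+ N) (+ k))) (below k))
  above′ : ∀ {m} → m < suc d → g (d ℕ.+ W ℕ.+ m) ≡ 0ℚ
  above′ {m} _ = trans (cong f (upper (+ d) (+ N) (+ m))) (above m)
  mirror : ∀ a b → suc (a ℕ.+ b) ≡ W → g (d ℕ.+ a) ≡ f (+ N ℤ.- + b)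
  mirror a b a+b+1≡W = cong f (begin
      + (d ℕ.+ a) ℤ.- + K
    ≡⟨ shift (+ d) (+ a) (+ b) (+ N) ⟩
      + (a ℕ.+ b) ℤ.- + suc N ℤ.- + b
    ≡⟨ cong (λ x → + x ℤ.- + suc N ℤ.- + b) (ℕP.suc-injective a+b+1≡W) ⟩
      + suc (N ℕ.+ N) ℤ.- + suc N ℤ.- + b
    ≡⟨ cancel (+ N) (+ b) ⟩
      + N ℤ.- + b
    ∎)
    where
    shift : ∀ d a b N → (d ℤ.+ a) ℤ.- ((ℤ.1ℤ ℤ.+ N) ℤ.+ d) ≡
                        (a ℤ.+ b) ℤ.- (ℤ.1ℤ ℤ.+ N) ℤ.- b
    shift = ℤ-Ring.solve-∀
    cancel : ∀ N b → (ℤ.1ℤ ℤ.+ (N ℤ.+ N)) ℤ.- (ℤ.1ℤ ℤ.+ N) ℤ.- b ≡ N ℤ.- b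
    cancel = ℤ-Ring.solve-∀

^ℚ-distribˡ-+-* : ∀ p m n → p ^ℚ (m ℕ.+ n) ≡ p ^ℚ m * p ^ℚ n
^ℚ-distribˡ-+-* p zero    n = sym (ℚP.*-identityˡ (p ^ℚ n))
^ℚ-distribˡ-+-* p (suc m) n =
  trans (cong (_*_ p) (^ℚ-distribˡ-+-* p m n)) (sym (ℚP.*-assoc p (p ^ℚ m) (p ^ℚ n)))

sgn-⊖ : ∀ m n → sgn (m ℤ.⊖ n) ≡ sgn (+ m) * sgn (+ n)
sgn-⊖ m       zero    = sym (ℚP.*-identityʳ (sgn (+ m)))
sgn-⊖ zero    (suc n) = sym (ℚP.*-identityˡ (sgn (+ suc n)))
sgn-⊖ (suc m) (suc n) =
  trans (cong sgn (ℤP.[1+m]⊖[1+n]≡m⊖n m n))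
        (trans (sgn-⊖ m n) (negate-both (sgn (+ m)) (sgn (+ n))))
  where
  negate-both : ∀ a b → a * b ≡ (- 1ℚ * a) * (- 1ℚ * b)
  negate-both = solve 2 (λ a b → a :* b := (:- con 1ℚ :* a) :* (:- con 1ℚ :* b)) refl

sgn-+ : ∀ i j → sgn (i ℤ.+ j) ≡ sgn i * sgn j
sgn-+ (+ m)    (+ n)    = ^ℚ-distribˡ-+-* (- 1ℚ) m n
sgn-+ (+ m)    -[1+ n ] = sgn-⊖ m (suc n)
sgn-+ -[1+ m ] (+ n)    = trans (sgn-⊖ n (suc m)) (ℚP.*-comm (sgn (+ n)) (sgn -[1+ m ]))
sgn-+ -[1+ m ] -[1+ n ] =
  trans (cong (λ k → sgn (+ suc k)) (sym (ℕP.+-suc m n)))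
        (^ℚ-distribˡ-+-* (- 1ℚ) (suc m) (suc n))

sgn-neg : ∀ i → sgn (ℤ.- i) ≡ sgn i
sgn-neg i = cong ((- 1ℚ) ^ℚ_) (ℤP.∣-i∣≡∣i∣ i)

triangular : ℕ → ℕ
triangular zero    = zero
triangular (suc n) = suc n ℕ.+ triangular n

n*[1+n]≡triangular*2 : ∀ n → n ℕ.* suc n ≡ triangular n ℕ.* 2
n*[1+n]≡triangular*2 zero    = refl
n*[1+n]≡triangular*2 (suc n) = begin
    suc n ℕ.* suc (suc n)
  ≡⟨ expand n ⟩
    suc n ℕ.* 2 ℕ.+ n ℕ.* suc n
  ≡⟨ cong (suc n ℕ.* 2 ℕ.+_) (n*[1+n]≡triangular*2 n) ⟩
    suc n ℕ.* 2 ℕ.+ triangular n ℕ.* 2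
  ≡⟨ sym (ℕP.*-distribʳ-+ 2 (suc n) (triangular n)) ⟩
    triangular (suc n) ℕ.* 2
  ∎
  where
  open ≡-Reasoning
  expand : ∀ n → suc n ℕ.* suc (suc n) ≡ suc n ℕ.* 2 ℕ.+ n ℕ.* suc n
  expand = ℕ-Ring.solve-∀

t*[t-1]≡pronic : ∀ t → ∃ λ k → t ℤ.* (t ℤ.- ℤ.1ℤ) ≡ + (k ℕ.* suc k)
t*[t-1]≡pronic (+ zero)  = 0 , refl
t*[t-1]≡pronic (+ suc n) = n , trans (positive (+ n)) (sym (ℤP.pos-* n (suc n)))
  where
  positive : ∀ x → (ℤ.1ℤ ℤ.+ x) ℤ.* ((ℤ.1ℤ ℤ.+ x) ℤ.- ℤ.1ℤ) ≡ x ℤ.* (ℤ.1ℤ ℤ.+ x)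
  positive = ℤ-Ring.solve-∀
t*[t-1]≡pronic -[1+ n ]  = suc n , trans (negative (+ n)) (sym (ℤP.pos-* (suc n) (suc (suc n))))
  where
  negative : ∀ x → ℤ.- (ℤ.1ℤ ℤ.+ x) ℤ.* (ℤ.- (ℤ.1ℤ ℤ.+ x) ℤ.- ℤ.1ℤ) ≡
                   (ℤ.1ℤ ℤ.+ x) ℤ.* (ℤ.1ℤ ℤ.+ (ℤ.1ℤ ℤ.+ x))
  negative = ℤ-Ring.solve-∀

binom2-*2 : ∀ t → + binom2 t ℤ.* + 2 ≡ t ℤ.* (t ℤ.- ℤ.1ℤ)
binom2-*2 t with t*[t-1]≡pronic t
... | k , t*[t-1]≡k*[1+k] = begin
    + (∣ t ℤ.* (t ℤ.- ℤ.1ℤ) ∣ ℕ./ 2) ℤ.* + 2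
  ≡⟨ cong (λ x → + (∣ x ∣ ℕ./ 2) ℤ.* + 2) t*[t-1]≡k*[1+k] ⟩
    + ((k ℕ.* suc k) ℕ./ 2) ℤ.* + 2
  ≡⟨ cong (λ n → + (n ℕ./ 2) ℤ.* + 2) (n*[1+n]≡triangular*2 k) ⟩
    + ((triangular k ℕ.* 2) ℕ./ 2) ℤ.* + 2
  ≡⟨ cong (λ n → + n ℤ.* + 2) (m*n/n≡m (triangular k) 2) ⟩
    + triangular k ℤ.* + 2
  ≡⟨ sym (ℤP.pos-* (triangular k) 2) ⟩
    + (triangular k ℕ.* 2)
  ≡⟨ cong +_ (sym (n*[1+n]≡triangular*2 k)) ⟩
    + (k ℕ.* suc k)
  ≡⟨ sym t*[t-1]≡k*[1+k] ⟩
    t ℤ.* (t ℤ.- ℤ.1ℤ)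
  ∎
  where open ≡-Reasoning

binom2-suc : ∀ t → + binom2 (t ℤ.+ ℤ.1ℤ) ≡ + binom2 t ℤ.+ t
binom2-suc t = ℤP.*-cancelʳ-≡ _ _ (+ 2) (begin
    + binom2 (t ℤ.+ ℤ.1ℤ) ℤ.* + 2
  ≡⟨ binom2-*2 (t ℤ.+ ℤ.1ℤ) ⟩
    (t ℤ.+ ℤ.1ℤ) ℤ.* ((t ℤ.+ ℤ.1ℤ) ℤ.- ℤ.1ℤ)
  ≡⟨ expand t ⟩
    t ℤ.* (t ℤ.- ℤ.1ℤ) ℤ.+ t ℤ.* + 2
  ≡⟨ cong (ℤ._+ t ℤ.* + 2) (sym (binom2-*2 t)) ⟩
    + binom2 t ℤ.* + 2 ℤ.+ t ℤ.* + 2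
  ≡⟨ sym (ℤP.*-distribʳ-+ (+ 2) (+ binom2 t) t) ⟩
    (+ binom2 t ℤ.+ t) ℤ.* + 2
  ∎)
  where
  open ≡-Reasoning
  expand : ∀ t → (t ℤ.+ ℤ.1ℤ) ℤ.* ((t ℤ.+ ℤ.1ℤ) ℤ.- ℤ.1ℤ) ≡
                 t ℤ.* (t ℤ.- ℤ.1ℤ) ℤ.+ t ℤ.* + 2
  expand = ℤ-Ring.solve-∀

binom2-reflect : ∀ t → binom2 (ℤ.1ℤ ℤ.- t) ≡ binom2 t
binom2-reflect t = cong (λ x → ∣ x ∣ ℕ./ 2) (reflect t)
  where
  reflect : ∀ t → (ℤ.1ℤ ℤ.- t) ℤ.* ((ℤ.1ℤ ℤ.- t) ℤ.- ℤ.1ℤ) ≡ t ℤ.* (t ℤ.- ℤ.1ℤ)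
  reflect = ℤ-Ring.solve-∀

p*r≢0 : ∀ {p r : ℚ} → p ≢ 0ℚ → r ≢ 0ℚ → p * r ≢ 0ℚ
p*r≢0 {p} {r} p≢0 r≢0 pr≡0 = r≢0 (begin
    r                  ≡⟨ sym (ℚP.*-identityˡ r) ⟩
    1ℚ * r             ≡⟨ cong (_* r) (sym (ℚP.*-inverseˡ p)) ⟩
    (ℚ.1/ p * p) * r   ≡⟨ ℚP.*-assoc (ℚ.1/ p) p r ⟩
    ℚ.1/ p * (p * r)   ≡⟨ cong (_*_ (ℚ.1/ p)) pr≡0 ⟩
    ℚ.1/ p * 0ℚ        ≡⟨ ℚP.*-zeroʳ (ℚ.1/ p) ⟩
    0ℚ                 ∎)
  where
  open ≡-Reasoning
  instance _ = ℚ.≢-nonZero p≢0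

p*inv[p]≡1 : ∀ p → p ≢ 0ℚ → p * inv p ≡ 1ℚ
p*inv[p]≡1 p p≢0 with p ℚP.≟ 0ℚ
... | yes p≡0 = contradiction p≡0 p≢0
... | no  p≢0 = ℚP.*-inverseʳ p {{ℚ.≢-nonZero p≢0}}

∣p^n∣≡∣p∣^n : ∀ p n → ℚ.∣ p ^ℚ n ∣ ≡ ℚ.∣ p ∣ ^ℚ n
∣p^n∣≡∣p∣^n p zero    = refl
∣p^n∣≡∣p∣^n p (suc n) =
  trans (ℚP.∣p*q∣≡∣p∣*∣q∣ p (p ^ℚ n)) (cong (_*_ ℚ.∣ p ∣) (∣p^n∣≡∣p∣^n p n))

module _ (a : ℚ) .{{_ : ℚ.NonNegative a}} where

  ^suc<1 : a ℚ.< 1ℚ → ∀ n → a ^ℚ suc n ℚ.< 1ℚ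
  ^suc<1 a<1 zero    = subst (ℚ._< 1ℚ) (sym (ℚP.*-identityʳ a)) a<1
  ^suc<1 a<1 (suc n) = ℚP.≤-<-trans
    (ℚP.≤-trans (ℚP.*-monoˡ-≤-nonNeg a (ℚP.<⇒≤ (^suc<1 a<1 n)))
                (ℚP.≤-reflexive (ℚP.*-identityʳ a)))
    a<1

  1<^suc : 1ℚ ℚ.< a → ∀ n → 1ℚ ℚ.< a ^ℚ suc n
  1<^suc 1<a zero    = subst (1ℚ ℚ.<_) (sym (ℚP.*-identityʳ a)) 1<a
  1<^suc 1<a (suc n) = ℚP.<-≤-trans 1<a
    (ℚP.≤-trans (ℚP.≤-reflexive (sym (ℚP.*-identityʳ a)))
                (ℚP.*-monoˡ-≤-nonNeg a (ℚP.<⇒≤ (1<^suc 1<a n))))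

  ^suc≡1⇒≡1 : ∀ n → a ^ℚ suc n ≡ 1ℚ → a ≡ 1ℚ
  ^suc≡1⇒≡1 n aⁿ⁺¹≡1 with ℚP.<-cmp a 1ℚ
  ... | tri< a<1 _ _ = contradiction aⁿ⁺¹≡1 (ℚP.<⇒≢ (^suc<1 a<1 n))
  ... | tri≈ _ a≡1 _ = a≡1
  ... | tri> _ _ 1<a = contradiction (sym aⁿ⁺¹≡1) (ℚP.<⇒≢ (1<^suc 1<a n))

^suc≢1 : ∀ {q} → q ≢ 1ℚ → q ≢ - 1ℚ → ∀ n → q ^ℚ suc n ≢ 1ℚ
^suc≢1 {q} q≢1 q≢-1 n qⁿ⁺¹≡1 = by-sign (ℚP.∣p∣≡p∨∣p∣≡-p q)
  where
  ∣q∣≡1 : ℚ.∣ q ∣ ≡ 1ℚ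
  ∣q∣≡1 = ^suc≡1⇒≡1 ℚ.∣ q ∣ {{ℚP.∣-∣-nonNeg q}} n
            (trans (sym (∣p^n∣≡∣p∣^n q (suc n))) (cong ℚ.∣_∣ qⁿ⁺¹≡1))
  double-negation : ∀ p → p ≡ - (- p)
  double-negation = solve 1 (λ p → p := :- (:- p)) refl
  by-sign : ℚ.∣ q ∣ ≡ q ⊎ ℚ.∣ q ∣ ≡ - q → ⊥
  by-sign (inj₁ ∣q∣≡q)  = q≢1 (trans (sym ∣q∣≡q) ∣q∣≡1)
  by-sign (inj₂ ∣q∣≡-q) =
    q≢-1 (trans (double-negation q) (cong -_ (trans (sym ∣q∣≡-q) ∣q∣≡1)))

module _ (q : ℚ) where

  -- [N; l]_q via the q-Pascal rule, which needs no division.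
  qBinom : ℕ → ℕ → ℚ
  qBinom N       zero    = 1ℚ
  qBinom zero    (suc l) = 0ℚ
  qBinom (suc N) (suc l) = qBinom N (suc l) + q ^ℚ (N ℕ.∸ l) * qBinom N l

  qBinom-above : ∀ {N l} → N < l → qBinom N l ≡ 0ℚ
  qBinom-above {zero}  {suc l} _            = refl
  qBinom-above {suc N} {suc l} (ℕ.s≤s N<l) =
    trans (cong₂ (λ x y → x + q ^ℚ (N ℕ.∸ l) * y)
                 (qBinom-above (ℕP.m<n⇒m<1+n N<l)) (qBinom-above N<l))
          (cong (_+_ 0ℚ) (ℚP.*-zeroʳ (q ^ℚ (N ℕ.∸ l))))

  qBinom-diag : ∀ N → qBinom N N ≡ 1ℚ
  qBinom-diag zero    = refl
  qBinom-diag (suc N) =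
    trans (cong₂ (λ x e → x + q ^ℚ e * qBinom N N)
                 (qBinom-above {N} ℕP.≤-refl) (ℕP.n∸n≡0 N))
          (cong (λ x → 0ℚ + 1ℚ * x) (qBinom-diag N))

  qBinom-*-poch : ∀ a b → qBinom (a ℕ.+ b) a * (poch q a * poch q b) ≡ poch q (a ℕ.+ b)
  qBinom-*-poch zero    b = trans (ℚP.*-identityˡ (1ℚ * poch q b)) (ℚP.*-identityˡ (poch q b))
  qBinom-*-poch (suc a) zero rewrite ℕP.+-identityʳ a =
    trans (cong (_* (poch q (suc a) * 1ℚ)) (qBinom-diag (suc a)))
          (trans (ℚP.*-identityˡ (poch q (suc a) * 1ℚ)) (ℚP.*-identityʳ (poch q (suc a))))
  qBinom-*-poch (suc a) (suc b) = begin
      (X + q ^ℚ (a ℕ.+ suc b ℕ.∸ a) * Y) * (poch q (suc a) * poch q (suc b))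
    ≡⟨ cong (λ e → (X + q ^ℚ e * Y) * (poch q (suc a) * poch q (suc b)))
            (ℕP.m+n∸m≡n a (suc b)) ⟩
      (X + B * Y) * ((pa * (1ℚ - A)) * (pb * (1ℚ - B)))
    ≡⟨ regroup X Y A B pa pb ⟩
      (X * ((pa * (1ℚ - A)) * pb)) * (1ℚ - B) + (B * (1ℚ - A)) * (Y * (pa * (pb * (1ℚ - B))))
    ≡⟨ cong₂ (λ u v → u * (1ℚ - B) + (B * (1ℚ - A)) * v) X-formula (qBinom-*-poch a (suc b)) ⟩
      P * (1ℚ - B) + (B * (1ℚ - A)) * P
    ≡⟨ collect P A B ⟩
      P * (1ℚ - A * B)
    ≡⟨ cong (λ x → P * (1ℚ - x)) (sym (^ℚ-distribˡ-+-* q (suc a) (suc b))) ⟩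
      poch q (suc (a ℕ.+ suc b))
    ∎
    where
    open ≡-Reasoning
    X = qBinom (a ℕ.+ suc b) (suc a)
    Y = qBinom (a ℕ.+ suc b) a
    A = q ^ℚ suc a
    B = q ^ℚ suc b
    pa = poch q a
    pb = poch q b
    P = poch q (a ℕ.+ suc b)
    X-formula : X * ((pa * (1ℚ - A)) * pb) ≡ P
    X-formula = subst (λ n → qBinom n (suc a) * (poch q (suc a) * pb) ≡ poch q n)
                      (sym (ℕP.+-suc a b)) (qBinom-*-poch (suc a) b)
    regroup : ∀ X Y A B pa pb →
      (X + B * Y) * ((pa * (1ℚ - A)) * (pb * (1ℚ - B))) ≡
      (X * ((pa * (1ℚ - A)) * pb)) * (1ℚ - B) + (B * (1ℚ - A)) * (Y * (pa * (pb * (1ℚ - B))))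
    regroup = solve 6 (λ X Y A B pa pb →
      (X :+ B :* Y) :* ((pa :* (con 1ℚ :- A)) :* (pb :* (con 1ℚ :- B))) :=
      (X :* ((pa :* (con 1ℚ :- A)) :* pb)) :* (con 1ℚ :- B)
        :+ (B :* (con 1ℚ :- A)) :* (Y :* (pa :* (pb :* (con 1ℚ :- B))))) refl
    collect : ∀ P A B → P * (1ℚ - B) + (B * (1ℚ - A)) * P ≡ P * (1ℚ - A * B)
    collect = solve 3 (λ P A B →
      P :* (con 1ℚ :- B) :+ (B :* (con 1ℚ :- A)) :* P := P :* (con 1ℚ :- A :* B)) refl

  qBinomialTerm : ℕ → ℤ → ℕ → ℚ
  qBinomialTerm N s l = sgn (+ l) * qBinom N l * q ^ℚ binom2 (+ l ℤ.- s)

  qBinomialSum : ℕ → ℤ → ℚ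
  qBinomialSum N s = ∑[ l < suc N ] qBinomialTerm N s l

  qBinomialTerm-suc : ∀ {N s e} → s ℤ.+ + e ≡ + N → ∀ l →
    qBinomialTerm (suc N) s (suc l) ≡ qBinomialTerm N s (suc l) + (- q ^ℚ e) * qBinomialTerm N s l
  qBinomialTerm-suc {N} {s} {e} s+e≡N l with l ℕ.≤? N
  ... | yes l≤N = begin
      (- 1ℚ * σ) * (b₁ + E * b₀) * P₁
    ≡⟨ expand σ b₁ E b₀ P₁ ⟩
      (- 1ℚ * σ) * b₁ * P₁ + (- (σ * b₀)) * (E * P₁)
    ≡⟨ cong (λ x → (- 1ℚ * σ) * b₁ * P₁ + (- (σ * b₀)) * x) E*P₁≡Q*P₀ ⟩
      (- 1ℚ * σ) * b₁ * P₁ + (- (σ * b₀)) * (Q * P₀)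
    ≡⟨ regroup σ b₁ P₁ b₀ Q P₀ ⟩
      (- 1ℚ * σ) * b₁ * P₁ + (- Q) * (σ * b₀ * P₀)
    ∎
    where
    open ≡-Reasoning
    σ = sgn (+ l)
    b₁ = qBinom N (suc l)
    b₀ = qBinom N l
    E = q ^ℚ (N ℕ.∸ l)
    P₁ = q ^ℚ binom2 (+ suc l ℤ.- s)
    P₀ = q ^ℚ binom2 (+ l ℤ.- s)
    Q = q ^ℚ e
    suc-shift : ∀ l s → (ℤ.1ℤ ℤ.+ l) ℤ.- s ≡ (l ℤ.- s) ℤ.+ ℤ.1ℤ
    suc-shift = ℤ-Ring.solve-∀
    cancel : ∀ s e l b → ((s ℤ.+ e) ℤ.- l) ℤ.+ (b ℤ.+ (l ℤ.- s)) ≡ e ℤ.+ b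
    cancel = ℤ-Ring.solve-∀
    exponent : (N ℕ.∸ l) ℕ.+ binom2 (+ suc l ℤ.- s) ≡ e ℕ.+ binom2 (+ l ℤ.- s)
    exponent = ℤP.+-injective (begin
        + (N ℕ.∸ l) ℤ.+ + binom2 (+ suc l ℤ.- s)
      ≡⟨ cong₂ ℤ._+_ (sym (trans (ℤP.m-n≡m⊖n N l) (ℤP.⊖-≥ l≤N)))
                     (cong (λ t → + binom2 t) (suc-shift (+ l) s)) ⟩
        (+ N ℤ.- + l) ℤ.+ + binom2 ((+ l ℤ.- s) ℤ.+ ℤ.1ℤ)
      ≡⟨ cong₂ (λ n b → (n ℤ.- + l) ℤ.+ b) (sym s+e≡N) (binom2-suc (+ l ℤ.- s)) ⟩
        ((s ℤ.+ + e) ℤ.- + l) ℤ.+ (+ binom2 (+ l ℤ.- s) ℤ.+ (+ l ℤ.- s))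
      ≡⟨ cancel s (+ e) (+ l) (+ binom2 (+ l ℤ.- s)) ⟩
        + e ℤ.+ + binom2 (+ l ℤ.- s)
      ∎)
    E*P₁≡Q*P₀ : E * P₁ ≡ Q * P₀
    E*P₁≡Q*P₀ = trans (sym (^ℚ-distribˡ-+-* q (N ℕ.∸ l) _))
                      (trans (cong (q ^ℚ_) exponent) (^ℚ-distribˡ-+-* q e _))
    expand : ∀ σ b₁ E b₀ P₁ →
      (- 1ℚ * σ) * (b₁ + E * b₀) * P₁ ≡ (- 1ℚ * σ) * b₁ * P₁ + (- (σ * b₀)) * (E * P₁)
    expand = solve 5 (λ σ b₁ E b₀ P₁ →
      (:- con 1ℚ :* σ) :* (b₁ :+ E :* b₀) :* P₁ :=
      (:- con 1ℚ :* σ) :* b₁ :* P₁ :+ (:- (σ :* b₀)) :* (E :* P₁)) refl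
    regroup : ∀ σ b₁ P₁ b₀ Q P₀ →
      (- 1ℚ * σ) * b₁ * P₁ + (- (σ * b₀)) * (Q * P₀) ≡
      (- 1ℚ * σ) * b₁ * P₁ + (- Q) * (σ * b₀ * P₀)
    regroup = solve 6 (λ σ b₁ P₁ b₀ Q P₀ →
      (:- con 1ℚ :* σ) :* b₁ :* P₁ :+ (:- (σ :* b₀)) :* (Q :* P₀) :=
      (:- con 1ℚ :* σ) :* b₁ :* P₁ :+ (:- Q) :* (σ :* b₀ :* P₀)) refl
  ... | no l≰N
    rewrite qBinom-above (ℕP.≰⇒> l≰N) | qBinom-above (ℕP.m<n⇒m<1+n (ℕP.≰⇒> l≰N)) =
    both-zero (sgn (+ l)) (q ^ℚ (N ℕ.∸ l)) (q ^ℚ binom2 (+ suc l ℤ.- s))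
              (q ^ℚ e) (q ^ℚ binom2 (+ l ℤ.- s))
    where
    both-zero : ∀ σ E P₁ Q P₀ →
      (- 1ℚ * σ) * (0ℚ + E * 0ℚ) * P₁ ≡ (- 1ℚ * σ) * 0ℚ * P₁ + (- Q) * (σ * 0ℚ * P₀)
    both-zero = solve 5 (λ σ E P₁ Q P₀ →
      (:- con 1ℚ :* σ) :* (con 0ℚ :+ E :* con 0ℚ) :* P₁ :=
      (:- con 1ℚ :* σ) :* con 0ℚ :* P₁ :+ (:- Q) :* (σ :* con 0ℚ :* P₀)) refl

  qBinomialSum-suc : ∀ {N s e} → s ℤ.+ + e ≡ + N →
                     qBinomialSum (suc N) s ≡ (1ℚ - q ^ℚ e) * qBinomialSum N s
  qBinomialSum-suc {N} {s} {e} s+e≡N = begin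
      ∑[ l < suc (suc N) ] qBinomialTerm (suc N) s l
    ≡⟨ ∑-shift (suc N) (qBinomialTerm (suc N) s) ⟩
      T 0 + ∑[ l < suc N ] qBinomialTerm (suc N) s (suc l)
    ≡⟨ cong (_+_ (T 0)) (∑-cong (suc N) (λ {l} _ → qBinomialTerm-suc {N} {s} {e} s+e≡N l)) ⟩
      T 0 + ∑[ l < suc N ] (T (suc l) + (- Q) * T l)
    ≡⟨ cong (_+_ (T 0)) (∑-distrib-+ (suc N) (λ l → T (suc l)) (λ l → (- Q) * T l)) ⟩
      T 0 + (∑[ l < suc N ] T (suc l) + ∑[ l < suc N ] ((- Q) * T l))
    ≡⟨ cong (λ x → T 0 + (∑[ l < suc N ] T (suc l) + x)) (sym (*-distribˡ-∑ (suc N) (- Q) T)) ⟩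
      T 0 + (∑[ l < suc N ] T (suc l) + (- Q) * V)
    ≡⟨ sym (ℚP.+-assoc (T 0) (∑[ l < suc N ] T (suc l)) ((- Q) * V)) ⟩
      (T 0 + ∑[ l < suc N ] T (suc l)) + (- Q) * V
    ≡⟨ cong (_+ (- Q) * V) (sym (∑-shift (suc N) T)) ⟩
      (T (suc N) + V) + (- Q) * V
    ≡⟨ cong (λ x → (x + V) + (- Q) * V) top-term ⟩
      (0ℚ + V) + (- Q) * V
    ≡⟨ factor V Q ⟩
      (1ℚ - Q) * V
    ∎
    where
    open ≡-Reasoning
    T = qBinomialTerm N s
    V = qBinomialSum N s
    Q = q ^ℚ e
    zero-middle : ∀ a b → a * 0ℚ * b ≡ 0ℚ
    zero-middle = solve 2 (λ a b → a :* con 0ℚ :* b := con 0ℚ) refl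
    top-term : T (suc N) ≡ 0ℚ
    top-term = trans (cong (λ b → sgn (+ suc N) * b * q ^ℚ binom2 (+ suc N ℤ.- s))
                           (qBinom-above {N} ℕP.≤-refl))
                     (zero-middle (sgn (+ suc N)) (q ^ℚ binom2 (+ suc N ℤ.- s)))
    factor : ∀ V Q → (0ℚ + V) + (- Q) * V ≡ (1ℚ - Q) * V
    factor = solve 2 (λ V Q → (con 0ℚ :+ V) :+ (:- Q) :* V := (con 1ℚ :- Q) :* V) refl

  qBinomialSum-[-1] : ∀ N → qBinomialSum N -[1+ 0 ] ≡ poch q N
  qBinomialSum-[-1] zero    = refl
  qBinomialSum-[-1] (suc N) =
    trans (qBinomialSum-suc {N} { -[1+ 0 ] } {suc N} refl)
          (trans (cong (_*_ (1ℚ - q ^ℚ suc N)) (qBinomialSum-[-1] N))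
                 (ℚP.*-comm (1ℚ - q ^ℚ suc N) (poch q N)))

  qBinomialSum-vanishes : ∀ {N t} → t ≤ N → qBinomialSum (suc N) (+ t) ≡ 0ℚ
  qBinomialSum-vanishes {t = t} t≤N with ℕP.m≤n⇒∃[o]m+o≡n t≤N
  ... | k , refl = vanishes k
    where
    vanishes : ∀ k → qBinomialSum (suc (t ℕ.+ k)) (+ t) ≡ 0ℚ
    vanishes zero    = trans (qBinomialSum-suc {t ℕ.+ 0} {+ t} {0} refl)
                             (ℚP.*-zeroˡ (qBinomialSum (t ℕ.+ 0) (+ t)))
    vanishes (suc k) =
      trans (qBinomialSum-suc {t ℕ.+ suc k} {+ t} {suc k} refl)
            (trans (cong (_*_ (1ℚ - q ^ℚ suc k))
                         (subst (λ n → qBinomialSum n (+ t) ≡ 0ℚ) (sym (ℕP.+-suc t k)) (vanishes k)))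
                   (ℚP.*-zeroʳ (1ℚ - q ^ℚ suc k)))

  kernel : ℤ → ℤ → ℚ
  kernel i j = sgn (i ℤ.+ j) * q ^ℚ binom2 (i ℤ.+ j ℤ.+ ℤ.1ℤ)

  oddGauss : ℕ → ℤ → ℚ
  oddGauss N i = gauss q (+ N ℤ.- i) (+ suc N ℤ.+ i)

  doubleSum : ℕ → ℕ → ℕ → ℚ
  doubleSum L M K = sumSym K (λ i → sumSym K (λ j → kernel i j * oddGauss L i * oddGauss M j))

  columnSum : ℕ → ℤ → ℚ
  columnSum M s = sgn s * qBinomialSum (suc (M ℕ.+ M)) s

  outerTerm : ℕ → ℕ → ℕ → ℚ
  outerTerm L M l = qBinom (suc (L ℕ.+ L)) l * columnSum M ((+ L ℤ.- + l) ℤ.+ + M)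

  kernel-comm : ∀ i j → kernel i j ≡ kernel j i
  kernel-comm i j = cong (λ t → sgn t * q ^ℚ binom2 (t ℤ.+ ℤ.1ℤ)) (ℤP.+-comm i j)

  kernel-reflect : ∀ i M l →
    kernel i (+ M ℤ.- + l) ≡ sgn (i ℤ.+ + M) * sgn (+ l) * q ^ℚ binom2 (+ l ℤ.- (i ℤ.+ + M))
  kernel-reflect i M l = cong₂ (λ σ b → σ * q ^ℚ b) sign exponent
    where
    regroup : ∀ i M l → i ℤ.+ (M ℤ.- l) ≡ (i ℤ.+ M) ℤ.+ ℤ.- l
    regroup = ℤ-Ring.solve-∀
    reflect : ∀ i M l → i ℤ.+ (M ℤ.- l) ℤ.+ ℤ.1ℤ ≡ ℤ.1ℤ ℤ.- (l ℤ.- (i ℤ.+ M))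
    reflect = ℤ-Ring.solve-∀
    sign : sgn (i ℤ.+ (+ M ℤ.- + l)) ≡ sgn (i ℤ.+ + M) * sgn (+ l)
    sign = trans (cong sgn (regroup i (+ M) (+ l)))
                 (trans (sgn-+ (i ℤ.+ + M) (ℤ.- + l)) (cong (_*_ (sgn (i ℤ.+ + M))) (sgn-neg (+ l))))
    exponent : binom2 (i ℤ.+ (+ M ℤ.- + l) ℤ.+ ℤ.1ℤ) ≡ binom2 (+ l ℤ.- (i ℤ.+ + M))
    exponent = trans (cong binom2 (reflect i (+ M) (+ l))) (binom2-reflect (+ l ℤ.- (i ℤ.+ + M)))

  gauss-negʳ : ∀ x k → gauss q x -[1+ k ] ≡ 0ℚ
  gauss-negʳ (+ n)    k = refl
  gauss-negʳ -[1+ n ] k = refl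

  oddGauss-above : ∀ N k → oddGauss N (+ N ℤ.+ + suc k) ≡ 0ℚ
  oddGauss-above N k =
    cong (λ x → gauss q x (+ suc N ℤ.+ (+ N ℤ.+ + suc k))) (overshoot (+ N) (+ k))
    where
    overshoot : ∀ N k → N ℤ.- (N ℤ.+ (ℤ.1ℤ ℤ.+ k)) ≡ ℤ.- (ℤ.1ℤ ℤ.+ k)
    overshoot = ℤ-Ring.solve-∀

  oddGauss-below : ∀ N k → oddGauss N (-[1+ N ] ℤ.- + suc k) ≡ 0ℚ
  oddGauss-below N k =
    trans (cong (gauss q (+ N ℤ.- i)) (undershoot (+ N) (+ k))) (gauss-negʳ (+ N ℤ.- i) k)
    where
    i = -[1+ N ] ℤ.- + suc k
    undershoot : ∀ N k → (ℤ.1ℤ ℤ.+ N) ℤ.+ (ℤ.- (ℤ.1ℤ ℤ.+ N) ℤ.- (ℤ.1ℤ ℤ.+ k)) ≡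
                         ℤ.- (ℤ.1ℤ ℤ.+ k)
    undershoot = ℤ-Ring.solve-∀

  outerTerm-vanishes : ∀ {L M l} → L ≤ M → l ≤ L ℕ.+ M → outerTerm L M l ≡ 0ℚ
  outerTerm-vanishes {L} {M} {l} L≤M l≤L+M = begin
      qBinom (suc (L ℕ.+ L)) l * columnSum M ((+ L ℤ.- + l) ℤ.+ + M)
    ≡⟨ cong (λ s → qBinom (suc (L ℕ.+ L)) l * columnSum M s) s≡t ⟩
      qBinom (suc (L ℕ.+ L)) l * (sgn (+ t) * qBinomialSum (suc (M ℕ.+ M)) (+ t))
    ≡⟨ cong (λ x → qBinom (suc (L ℕ.+ L)) l * (sgn (+ t) * x)) (qBinomialSum-vanishes t≤2M) ⟩
      qBinom (suc (L ℕ.+ L)) l * (sgn (+ t) * 0ℚ)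
    ≡⟨ zero-right (qBinom (suc (L ℕ.+ L)) l) (sgn (+ t)) ⟩
      0ℚ
    ∎
    where
    open ≡-Reasoning
    t = L ℕ.+ M ℕ.∸ l
    regroup : ∀ L l M → (L ℤ.- l) ℤ.+ M ≡ (L ℤ.+ M) ℤ.- l
    regroup = ℤ-Ring.solve-∀
    s≡t : (+ L ℤ.- + l) ℤ.+ + M ≡ + t
    s≡t = trans (regroup (+ L) (+ l) (+ M)) (trans (ℤP.m-n≡m⊖n (L ℕ.+ M) l) (ℤP.⊖-≥ l≤L+M))
    t≤2M : t ≤ M ℕ.+ M
    t≤2M = ℕP.≤-trans (ℕP.m∸n≤m (L ℕ.+ M) l) (ℕP.+-monoˡ-≤ M L≤M)
    zero-right : ∀ a b → a * (b * 0ℚ) ≡ 0ℚ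
    zero-right = solve 2 (λ a b → a :* (b :* con 0ℚ) := con 0ℚ) refl

  outerTerm-corner : ∀ L → outerTerm L L (suc (L ℕ.+ L)) ≡ - poch q (suc (L ℕ.+ L))
  outerTerm-corner L = begin
      qBinom N N * columnSum L ((+ L ℤ.- + N) ℤ.+ + L)
    ≡⟨ cong₂ (λ b s → b * columnSum L s) (qBinom-diag N) (minus-one (+ L)) ⟩
      1ℚ * (- 1ℚ * qBinomialSum N -[1+ 0 ])
    ≡⟨ cong (λ x → 1ℚ * (- 1ℚ * x)) (qBinomialSum-[-1] N) ⟩
      1ℚ * (- 1ℚ * poch q N)
    ≡⟨ negation (poch q N) ⟩
      - poch q N
    ∎
    where
    open ≡-Reasoning
    N = suc (L ℕ.+ L)
    minus-one : ∀ L → (L ℤ.- (ℤ.1ℤ ℤ.+ (L ℤ.+ L))) ℤ.+ L ≡ ℤ.- ℤ.1ℤ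
    minus-one = ℤ-Ring.solve-∀
    negation : ∀ p → 1ℚ * (- 1ℚ * p) ≡ - p
    negation = solve 1 (λ p → con 1ℚ :* (:- con 1ℚ :* p) := :- p) refl

  doubleSum-comm : ∀ L M K → doubleSum L M K ≡ doubleSum M L K
  doubleSum-comm L M K =
    trans (sumSym-swap K (λ i j → kernel i j * oddGauss L i * oddGauss M j))
          (sumSym-cong K (λ j → sumSym-cong K (λ i → swap-factors i j)))
    where
    exchange : ∀ k a b → k * a * b ≡ k * b * a
    exchange = solve 3 (λ k a b → k :* a :* b := k :* b :* a) refl
    swap-factors : ∀ i j → kernel i j * oddGauss L i * oddGauss M j ≡
                           kernel j i * oddGauss M j * oddGauss L i
    swap-factors i j = trans (cong (λ k → k * oddGauss L i * oddGauss M j) (kernel-comm i j))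
                             (exchange (kernel j i) (oddGauss L i) (oddGauss M j))

  -- The only rational roots of unity are ±1, so here the q-Pochhammer symbols that gauss
  -- divides by are nonzero.
  module _ (q≢1 : q ≢ 1ℚ) (q≢-1 : q ≢ - 1ℚ) where

    poch≢0 : ∀ n → poch q n ≢ 0ℚ
    poch≢0 zero    = ℚP.1≢0
    poch≢0 (suc n) = p*r≢0 (poch≢0 n)
      (λ 1-qⁿ⁺¹≡0 → ^suc≢1 q≢1 q≢-1 n (sym (x∙y⁻¹≈ε⇒x≈y 1ℚ (q ^ℚ suc n) 1-qⁿ⁺¹≡0)))

    gauss≡qBinom : ∀ a b → gauss q (+ a) (+ b) ≡ qBinom (a ℕ.+ b) a
    gauss≡qBinom a b = begin
        poch q (a ℕ.+ b) * inv D
      ≡⟨ cong (_* inv D) (sym (qBinom-*-poch a b)) ⟩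
        qBinom (a ℕ.+ b) a * D * inv D
      ≡⟨ ℚP.*-assoc (qBinom (a ℕ.+ b) a) D (inv D) ⟩
        qBinom (a ℕ.+ b) a * (D * inv D)
      ≡⟨ cong (_*_ (qBinom (a ℕ.+ b) a)) (p*inv[p]≡1 D (p*r≢0 (poch≢0 a) (poch≢0 b))) ⟩
        qBinom (a ℕ.+ b) a * 1ℚ
      ≡⟨ ℚP.*-identityʳ (qBinom (a ℕ.+ b) a) ⟩
        qBinom (a ℕ.+ b) a
      ∎
      where
      open ≡-Reasoning
      D = poch q a * poch q b

    oddGauss≡qBinom : ∀ {N l} → l ≤ suc (N ℕ.+ N) →
                      oddGauss N (+ N ℤ.- + l) ≡ qBinom (suc (N ℕ.+ N)) l
    oddGauss≡qBinom {N} {l} l≤2N+1 with ℕP.m≤n⇒∃[o]m+o≡n l≤2N+1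
    ... | r , l+r≡2N+1 = begin
        gauss q (+ N ℤ.- (+ N ℤ.- + l)) (+ suc N ℤ.+ (+ N ℤ.- + l))
      ≡⟨ cong₂ (gauss q) (cancel (+ N) (+ l)) complement ⟩
        gauss q (+ l) (+ r)
      ≡⟨ gauss≡qBinom l r ⟩
        qBinom (l ℕ.+ r) l
      ≡⟨ cong (λ n → qBinom n l) l+r≡2N+1 ⟩
        qBinom (suc (N ℕ.+ N)) l
      ∎
      where
      open ≡-Reasoning
      cancel : ∀ N l → N ℤ.- (N ℤ.- l) ≡ l
      cancel = ℤ-Ring.solve-∀
      regroup : ∀ N l → (ℤ.1ℤ ℤ.+ N) ℤ.+ (N ℤ.- l) ≡ (ℤ.1ℤ ℤ.+ (N ℤ.+ N)) ℤ.- l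
      regroup = ℤ-Ring.solve-∀
      cancel′ : ∀ l r → (l ℤ.+ r) ℤ.- l ≡ r
      cancel′ = ℤ-Ring.solve-∀
      complement : + suc N ℤ.+ (+ N ℤ.- + l) ≡ + r
      complement = begin
          + suc N ℤ.+ (+ N ℤ.- + l)  ≡⟨ regroup (+ N) (+ l) ⟩
          + suc (N ℕ.+ N) ℤ.- + l    ≡⟨ cong (λ n → + n ℤ.- + l) (sym l+r≡2N+1) ⟩
          + (l ℕ.+ r) ℤ.- + l        ≡⟨ cancel′ (+ l) (+ r) ⟩
          + r                        ∎

    sumSym-column : ∀ {M K} → suc M ≤ K → ∀ i c →
      sumSym K (λ j → kernel i j * c * oddGauss M j) ≡ c * columnSum M (i ℤ.+ + M)
    sumSym-column {M} {K} M<K i c = begin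
        sumSym K f
      ≡⟨ sumSym-window M f M<K (λ k → outside { -[1+ M ] ℤ.- + suc k } (oddGauss-below M k))
                               (λ k → outside { + M ℤ.+ + suc k } (oddGauss-above M k)) ⟩
        ∑[ l < suc N ] f (+ M ℤ.- + l)
      ≡⟨ ∑-cong (suc N) (λ {l} l<N+1 → term l (ℕP.≤-pred l<N+1)) ⟩
        ∑[ l < suc N ] ((c * sgn s) * qBinomialTerm N s l)
      ≡⟨ sym (*-distribˡ-∑ (suc N) (c * sgn s) (qBinomialTerm N s)) ⟩
        (c * sgn s) * qBinomialSum N s
      ≡⟨ ℚP.*-assoc c (sgn s) (qBinomialSum N s) ⟩
        c * columnSum M s
      ∎
      where
      open ≡-Reasoning
      N = suc (M ℕ.+ M)
      s = i ℤ.+ + M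
      f : ℤ → ℚ
      f j = kernel i j * c * oddGauss M j
      outside : ∀ {j} → oddGauss M j ≡ 0ℚ → f j ≡ 0ℚ
      outside {j} eq = trans (cong (_*_ (kernel i j * c)) eq) (ℚP.*-zeroʳ (kernel i j * c))
      regroup : ∀ a b P c d → a * b * P * c * d ≡ (c * a) * (b * d * P)
      regroup = solve 5 (λ a b P c d → a :* b :* P :* c :* d := (c :* a) :* (b :* d :* P)) refl
      term : ∀ l → l ≤ N → f (+ M ℤ.- + l) ≡ (c * sgn s) * qBinomialTerm N s l
      term l l≤N = trans (cong₂ (λ k g → k * c * g) (kernel-reflect i M l) (oddGauss≡qBinom {M} l≤N))
                         (regroup (sgn s) (sgn (+ l)) (q ^ℚ binom2 (+ l ℤ.- s)) c (qBinom N l))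

    doubleSum≡∑outerTerm : ∀ {L M K} → suc L ≤ K → suc M ≤ K →
                           doubleSum L M K ≡ ∑[ l < suc (suc (L ℕ.+ L)) ] outerTerm L M l
    doubleSum≡∑outerTerm {L} {M} {K} L<K M<K = begin
        doubleSum L M K
      ≡⟨ sumSym-cong K (λ i → sumSym-column M<K i (oddGauss L i)) ⟩
        sumSym K g
      ≡⟨ sumSym-window L g L<K (λ k → outside { -[1+ L ] ℤ.- + suc k } (oddGauss-below L k))
                               (λ k → outside { + L ℤ.+ + suc k } (oddGauss-above L k)) ⟩
        ∑[ l < suc (suc (L ℕ.+ L)) ] g (+ L ℤ.- + l)
      ≡⟨ ∑-cong (suc (suc (L ℕ.+ L))) (λ {l} l<2L+2 →
           cong (_* columnSum M ((+ L ℤ.- + l) ℤ.+ + M))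
                (oddGauss≡qBinom {L} (ℕP.≤-pred l<2L+2))) ⟩
        ∑[ l < suc (suc (L ℕ.+ L)) ] outerTerm L M l
      ∎
      where
      open ≡-Reasoning
      g : ℤ → ℚ
      g i = oddGauss L i * columnSum M (i ℤ.+ + M)
      outside : ∀ {i} → oddGauss L i ≡ 0ℚ → g i ≡ 0ℚ
      outside {i} eq =
        trans (cong (_* columnSum M (i ℤ.+ + M)) eq) (ℚP.*-zeroˡ (columnSum M (i ℤ.+ + M)))

    doubleSum-offDiagonal : ∀ {L M K} → L < M → suc L ≤ K → suc M ≤ K → doubleSum L M K ≡ 0ℚ
    doubleSum-offDiagonal {L} {M} L<M L<K M<K =
      trans (doubleSum≡∑outerTerm L<K M<K)
            (∑-zero (suc (suc (L ℕ.+ L)))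
                    (λ l<2L+2 → outerTerm-vanishes (ℕP.<⇒≤ L<M) (bound l<2L+2)))
      where
      bound : ∀ {l} → l < suc (suc (L ℕ.+ L)) → l ≤ L ℕ.+ M
      bound l<2L+2 = ℕP.≤-trans (ℕP.≤-pred l<2L+2)
                       (ℕP.≤-trans (ℕP.≤-reflexive (sym (ℕP.+-suc L L))) (ℕP.+-monoʳ-≤ L L<M))

    doubleSum-diagonal : ∀ {L K} → suc L ≤ K → doubleSum L L K ≡ - poch q (suc (L ℕ.+ L))
    doubleSum-diagonal {L} {K} L<K = begin
        doubleSum L L K
      ≡⟨ doubleSum≡∑outerTerm L<K L<K ⟩
        outerTerm L L N + ∑[ l < N ] outerTerm L L l
      ≡⟨ cong₂ _+_ (outerTerm-corner L)
                   (∑-zero N (λ l<N → outerTerm-vanishes {L} ℕP.≤-refl (ℕP.≤-pred l<N))) ⟩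
        - poch q N + 0ℚ
      ≡⟨ ℚP.+-identityʳ (- poch q N) ⟩
        - poch q N
      ∎
      where
      open ≡-Reasoning
      N = suc (L ℕ.+ L)

-[p*δ]≡0 : ∀ p {m n} → m ≢ n → - (p * δ m n) ≡ 0ℚ
-[p*δ]≡0 p {m} {n} m≢n with m ℕ.≟ n
... | yes m≡n = contradiction m≡n m≢n
... | no _    = cong -_ (ℚP.*-zeroʳ p)

-[p*δ[n,n]]≡-p : ∀ p n → - (p * δ n n) ≡ - p
-[p*δ[n,n]]≡-p p n with n ℕ.≟ n
... | yes _   = cong -_ (ℚP.*-identityʳ p)
... | no n≢n = contradiction refl n≢n

mainTheorem7 : (q : ℚ) → q ≢ 1ℚ → q ≢ - 1ℚ → (L M K : ℕ) → suc L ≤ K → suc M ≤ K →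
    sumSym K (λ i → sumSym K (λ j →
      sgn (i ℤ.+ j) * (q ^ℚ binom2 (i ℤ.+ j ℤ.+ ℤ.1ℤ))
        * gauss q ((+ L) ℤ.- i) ((+ (suc L)) ℤ.+ i)
        * gauss q ((+ M) ℤ.- j) ((+ (suc M)) ℤ.+ j)))
    ≡ - (poch q (suc (L ℕ.+ L)) * δ L M)
mainTheorem7 q q≢1 q≢-1 L M K L<K M<K with ℕP.<-cmp L M
... | tri< L<M _ _ =
  trans (doubleSum-offDiagonal q q≢1 q≢-1 L<M L<K M<K)
        (sym (-[p*δ]≡0 (poch q (suc (L ℕ.+ L))) (ℕP.<⇒≢ L<M)))
... | tri≈ _ refl _ =
  trans (doubleSum-diagonal q q≢1 q≢-1 L<K)
        (sym (-[p*δ[n,n]]≡-p (poch q (suc (L ℕ.+ L))) L))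
... | tri> _ _ M<L =
  trans (doubleSum-comm q L M K)
        (trans (doubleSum-offDiagonal q q≢1 q≢-1 M<L M<K L<K)
               (sym (-[p*δ]≡0 (poch q (suc (L ℕ.+ L))) (ℕP.>⇒≢ M<L))))
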